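{- Let $n\ge 2$ and let $Y$ be a Young diagram fitting in an $(n-1)\times(n-1)$ square, and let $D(Y)$ be the associated double wiring diagram. For $1\le t\le n$ label the chambers of track $t$ of $D(Y)$ from left to right as $(n,t),(n-1,t),\dots,(t+1,t),(t,t),(t,t+1),\dots,(t,n)$. Define an $n\times n$ array $(m_{ij})$ by letting $m_{ij}$ be the minor associated to chamber $(i,j)$. Then for every $j\in[n]$, $$m_{jj}=\left|X_{[1+D_j,\,j+D_j],\,[1+D_j,\,j+D_j]}\right|,$$ and for all $1\le i<j\le n$, $$m_{ij}=\left|X_{[1+P_{j,i},\,i+P_{j,i}],\,[j-i+P_{j,i}+1,\,j+P_{j,i}]}\right|,\qquad m_{ji}=\left|X_{[j-i+B_{j,i}+1,\,j+B_{j,i}],\,[1+B_{j,i},\,i+B_{j,i}]}\right|,$$ where $D_j$ is the minimum of $n-j$ and the number of boxes of $Y$ on the main diagonal, $P_{j,i}$ is the minimum of $n-j$ and the number of boxes of $Y$ on the $(j-i)$-th diagonal above the main diagonal, and $B_{j,i}$ is the minimum of $n-j$ and the number of boxes of $Y$ on the $(j-i)$-th diagonal below the main diagonal.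
   Context: $X=(x_{ij})$ is an $n\times n$ matrix of indeterminates; $|X_{R,C}|$ denotes the minor with rows $R$ and columns $C$; $[a,b]=\{a,\dots,b\}$. Young diagrams are in English notation (rows top to bottom, weakly decreasing lengths); the box in row $r$, column $c$ lies on the $d$-th diagonal above (resp. below) the main diagonal if $c-r=d$ (resp. $r-c=d$), and on the main diagonal if $r=c$. Double wiring diagrams as words: a double wiring diagram is a word in letters $e_s,f_s$ ($1\le s\le n-1$) read left to right. There are $n$ red and $n$ blue wires; at the left end the red wires occupy heights $1,\dots,n$ (bottom to top) in the order $n,n-1,\dots,1$ and the blue wires in the order $1,2,\dots,n$. The letter $e_s$ (a red crossing in track $s$) swaps the red wires at heights $s$ and $s+1$; $f_s$ (a blue crossing in track $s$) swaps the blue wires at heights $s$ and $s+1$. Track $t$ is the horizontal band between heights $t$ and $t+1$ (track $n$ is the band above height $n$); its chambers are the maximal regions of this band not separated by crossings in track $t$ (letters $e_t,f_t$). A chamber of track $t$ gets the label $(r,b)$ where $r$ (resp. $b$) is the set of red (resp. blue) wires at heights $1,\dots,t$ there, and its associated minor is $|X_{r,b}|$. The diagram $D(Y)$: put $r_i=e_{n-i}\cdots e_2e_1$ and $b_i=f_1f_2\cdots f_{n-i}$ for $1\le i\le n-1$. Let $\ell_i$ be the number of boxes in row $i$ of $Y$. Start with the word $b_1b_2\cdots b_{n-1}$ and, for each $i\in[n-1]$, insert $r_i$ between $b_{\ell_i}$ and $b_{\ell_i+1}$ (at the very beginning if $\ell_i=0$, at the end if $\ell_i=n-1$); if several $r_j$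 are inserted in the same gap, they are arranged in decreasing order of $j$ from left to right. With these conventions track $t$ of $D(Y)$ has exactly $2(n-t)+1$ chambers. -}

module Defs where

open import Data.Nat using (ℕ; zero; suc; _+_; _*_; _∸_; _≤_; _<_; _≤ᵇ_; _≡ᵇ_; _⊔_; _⊓_)
open import Data.Nat.Properties using (_≟_; _≤?_)
open import Data.Bool using (Bool; true; false; if_then_else_; _∨_)
open import Data.List using (List; []; _∷_; _++_; map; upTo; reverse; concatMap; filter; cartesianProduct; length; drop; head)
open import Data.List.Relation.Binary.Permutation.Propositional using (_↭_)
open import Data.Maybe using (Maybe; just; nothing)
open import Data.Product using (_×_; _,_; proj₁; proj₂)
open import Data.Empty using (⊥)

-- Intervals [a,b] = {a,…,b} (as an ascending list; empty if b < a)

interval : ℕ → ℕ → List ℕ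
interval a b = map (a +_) (upTo (suc b ∸ a))

-- Young diagrams fitting in an (n-1)×(n-1) square.
-- row i = ℓ_i = number of boxes in row i, for i ∈ [1, n-1]
-- (values of `row` outside [1,n-1] are irrelevant and never used).

record Young (n : ℕ) : Set where
  field
    row       : ℕ → ℕ
    weaklyDec : ∀ i → 1 ≤ i → suc i ≤ n ∸ 1 → row (suc i) ≤ row i
    bounded   : ∀ i → 1 ≤ i → i ≤ n ∸ 1 → row i ≤ n ∸ 1
open Young public

boxes : (n : ℕ) → Young n → List (ℕ × ℕ)
boxes n Y = filter (λ p → proj₂ p ≤? row Y (proj₁ p))
                   (cartesianProduct (interval 1 (n ∸ 1)) (interval 1 (n ∸ 1)))

boxesAbove : (n : ℕ) → Young n → ℕ → ℕ
boxesAbove n Y d = length (filter (λ p → proj₂ p ≟ proj₁ p + d) (boxes n Y))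

boxesBelow : (n : ℕ) → Young n → ℕ → ℕ
boxesBelow n Y d = length (filter (λ p → proj₁ p ≟ proj₂ p + d) (boxes n Y))

boxesMain : (n : ℕ) → Young n → ℕ
boxesMain n Y = boxesAbove n Y 0

-- Double wiring diagrams as words in e_s (red crossing), f_s (blue crossing)

data Letter : Set where
  e f : ℕ → Letter

redWord : ℕ → ℕ → List Letter
redWord n i = map e (reverse (interval 1 (n ∸ i)))

blueWord : ℕ → ℕ → List Letter
blueWord n i = map f (interval 1 (n ∸ i))

-- the r_j inserted in gap g (i.e. right after b_g; g = 0 is the very
-- beginning), in decreasing order of j
gapReds : (n : ℕ) → Young n → ℕ → List Letter
gapReds n Y g = concatMap (redWord n)
                  (filter (λ j → row Y j ≟ g) (reverse (interval 1 (n ∸ 1))))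

gapBlue : ℕ → ℕ → List Letter
gapBlue n g = if suc g ≤ᵇ n ∸ 1 then blueWord n (suc g) else []

-- D(Y) = (reds in gap 0) b_1 (reds in gap 1) b_2 ⋯ b_{n-1} (reds in gap n-1)
DY : (n : ℕ) → Young n → List Letter
DY n Y = concatMap (λ g → gapReds n Y g ++ gapBlue n g) (upTo n)

-- Wire positions: red h / blue h = the red / blue wire at height h

record State : Set where
  field
    red  : ℕ → ℕ
    blue : ℕ → ℕ
open State public

initState : ℕ → State
initState n = record { red = λ h → suc n ∸ h ; blue = λ h → h }

swapAt : ℕ → ℕ → ℕ
swapAt s h = if h ≡ᵇ s then suc s else (if h ≡ᵇ suc s then s else h)

step : State → Letter → State
step st (e s) = record { red = λ h → red st (swapAt s h) ; blue = blue st }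
step st (f s) = record { red = red st ; blue = λ h → blue st (swapAt s h) }

inTrack : ℕ → Letter → Bool
inTrack t (e s) = s ≡ᵇ t
inTrack t (f s) = s ≡ᵇ t

afterTrackCrossings : ℕ → State → List Letter → List State
afterTrackCrossings t st [] = []
afterTrackCrossings t st (x ∷ w) with inTrack t x
... | true  = step st x ∷ afterTrackCrossings t (step st x) w
... | false = afterTrackCrossings t (step st x) w

-- a representative state in each chamber of track t, left to right
chamberStates : ℕ → List Letter → ℕ → List State
chamberStates n w t = initState n ∷ afterTrackCrossings t (initState n) w

-- Minors |X_{R,C}|, recorded by their row set R and column set C.

record Minor : Set where
  constructor minor
  field
    rows : List ℕ
    cols : List ℕ
open Minor public

SameMinor : Minor → Minor → Set
SameMinor M N = (rows M ↭ rows N) × (cols M ↭ cols N)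

labelMinor : ℕ → State → Minor
labelMinor t st = minor (map (red st) (interval 1 t)) (map (blue st) (interval 1 t))

-- minor of the k-th chamber (0-based, left to right) of track t, if it exists
chamberMinor : ℕ → List Letter → ℕ → ℕ → Maybe Minor
chamberMinor n w t k with head (drop k (chamberStates n w t))
... | just st = just (labelMinor t st)
... | nothing = nothing

-- chamber (i,j): track j, chamber index n-i when i ≥ j;
--                track i, chamber index (n-i)+(j-i) when i ≤ j.
-- (Labels (n,t),…,(t,t),(t,t+1),…,(t,n) from left to right.)
mEntry : (n : ℕ) → Young n → ℕ → ℕ → Maybe Minor
mEntry n Y i j = if j ≤ᵇ i then chamberMinor n (DY n Y) j (n ∸ i)
                           else chamberMinor n (DY n Y) i ((n ∸ i) + (j ∸ i))

_IsMinor_ : Maybe Minor → Minor → Set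
just M  IsMinor N = SameMinor M N
nothing IsMinor N = ⊥

X[_,_][_,_] : ℕ → ℕ → ℕ → ℕ → Minor
X[ a , b ][ c , d ] = minor (interval a b) (interval c d)

D : (n : ℕ) → Young n → ℕ → ℕ
D n Y j = (n ∸ j) ⊓ boxesMain n Y

P : (n : ℕ) → Young n → ℕ → ℕ → ℕ
P n Y j i = (n ∸ j) ⊓ boxesAbove n Y (j ∸ i)

B : (n : ℕ) → Young n → ℕ → ℕ → ℕ
B n Y j i = (n ∸ j) ⊓ boxesBelow n Y (j ∸ i)

module Submission where

-- After D(Y) has read the red words r_N, …, r_{a+1} and the blue words b_1, …, b_g, the red and the
-- blue wires are in "tent" arrangements that depend on a and g alone, so every chamber of track t
-- carries the label ([ρ+1, ρ+t], [κ+1, κ+t]) with ρ = min(a, s), κ = min(g, s), s = n − t. The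
-- words that cross track t are exactly the r_a and b_g with a, g ≤ s, one crossing each, so chamber
-- number k satisfies k + ρ = s + κ. Because D(Y) interleaves the words along the boundary path of Y,
-- (a, g) lies on that path, so the boxes of Y on the diagonal through (ρ, κ) are exactly those in
-- rows 1, …, ρ (resp. columns 1, …, κ), up to the cap at s; counting them gives the minima D, P, B.

open import Defs
open import Data.Nat
open import Data.Nat.Properties
open import Relation.Nullary.Decidable using (_×-dec_)
open import Data.List using (List; []; _∷_; _++_; head; drop; map; concat; concatMap; length; filter; applyUpTo; applyDownFrom; reverse; cartesianProduct; [_]; foldl; _∷ʳ_)
open import Data.List.Properties using (map-cong-local; map-∘; ++-assoc; map-++; filter-++; length-++; length-filter; filter-accept; filter-reject; filter-all; filter-none; map-applyUpTo; reverse-applyUpTo)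
open import Data.List.Relation.Unary.All using (All; []; _∷_)
open import Data.List.Relation.Unary.All.Properties using (applyDownFrom⁺₁)
open import Data.List.Relation.Binary.Permutation.Propositional using (_↭_; ↭-refl; ↭-trans; ↭-reflexive; module PermutationReasoning)
open import Data.List.Relation.Binary.Permutation.Propositional.Properties using (↭-reverse; ∷↭∷ʳ; ++⁺ˡ; ++-comm)
open import Data.Product using (Σ; _×_; _,_; proj₁; proj₂)
open import Function using (_∘_; Equivalence)
open import Data.Bool using (true; false; if_then_else_)
open import Data.Bool.Properties using (T-≡; ¬-not)
open import Data.Sum using (inj₁; inj₂)
open import Data.Empty using (⊥-elim)
open import Data.Maybe using (just)
open import Data.Nat.Tactic.RingSolver using (solve-∀)
open import Level using (0ℓ)
open import Relation.Binary.PropositionalEquality hiding ([_])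
open import Relation.Nullary using (¬_; Dec; yes; no)
open import Relation.Unary using (Pred; Decidable; ∁)
open import Relation.Unary.Properties using (_∩?_)

≤ᵇ-true : ∀ {m n} → m ≤ n → (m ≤ᵇ n) ≡ true
≤ᵇ-true = Equivalence.to T-≡ ∘ ≤⇒≤ᵇ

≤ᵇ-false : ∀ {m n} → n < m → (m ≤ᵇ n) ≡ false
≤ᵇ-false {m} {n} n<m = ¬-not (λ m≤ᵇn → <⇒≱ n<m (≤ᵇ⇒≤ m n (Equivalence.from T-≡ m≤ᵇn)))

⊓-suc-below : ∀ {a s} → a < s → suc a ⊓ s ≡ suc (a ⊓ s)
⊓-suc-below a<s = trans (m≤n⇒m⊓n≡m a<s) (cong suc (sym (m≤n⇒m⊓n≡m (<⇒≤ a<s))))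

⊓-suc-above : ∀ {a s} → s ≤ a → suc a ⊓ s ≡ a ⊓ s
⊓-suc-above s≤a = trans (m≥n⇒m⊓n≡n (m≤n⇒m≤1+n s≤a)) (sym (m≥n⇒m⊓n≡n s≤a))

⊓-<-right : ∀ {m n} → m ⊓ n < n → m ⊓ n ≡ m
⊓-<-right {m} {n} m⊓n<n with m ≤? n
... | yes m≤n = m≤n⇒m⊓n≡m m≤n
... | no  m≰n = ⊥-elim (<-irrefl (m≥n⇒m⊓n≡n (<⇒≤ (≰⇒> m≰n))) m⊓n<n)

⊓-characterisation : ∀ {x y ρ} → ρ ≤ x → ρ ≤ y → (ρ < x → y ≤ ρ) → x ⊓ y ≡ ρ
⊓-characterisation ρ≤x ρ≤y bound with m≤n⇒m<n∨m≡n ρ≤x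
... | inj₁ ρ<x  = trans (m≥n⇒m⊓n≡n (≤-trans (bound ρ<x) ρ≤x)) (≤-antisym (bound ρ<x) ρ≤y)
... | inj₂ refl = m≤n⇒m⊓n≡m ρ≤y

segment : ℕ → ℕ → List ℕ
segment a zero    = []
segment a (suc c) = a ∷ segment (suc a) c

length-segment : ∀ a c → length (segment a c) ≡ c
length-segment a zero    = refl
length-segment a (suc c) = cong suc (length-segment (suc a) c)

segment-++ : ∀ a c₁ c₂ → segment a (c₁ + c₂) ≡ segment a c₁ ++ segment (a + c₁) c₂
segment-++ a zero     c₂ = cong (λ b → segment b c₂) (sym (+-identityʳ a))
segment-++ a (suc c₁) c₂ =
  cong (a ∷_) (trans (segment-++ (suc a) c₁ c₂) (cong (λ b → segment (suc a) c₁ ++ segment b c₂) (sym (+-suc a c₁))))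

applyUpTo-segment : ∀ {f : ℕ → ℕ} a c → (∀ x → f x ≡ a + x) → applyUpTo f c ≡ segment a c
applyUpTo-segment a zero    f≗ = refl
applyUpTo-segment a (suc c) f≗ =
  cong₂ _∷_ (trans (f≗ 0) (+-identityʳ a)) (applyUpTo-segment (suc a) c (λ x → trans (f≗ (suc x)) (+-suc a x)))

interval-segment : ∀ a b → interval a b ≡ segment a (suc b ∸ a)
interval-segment a b = trans (map-applyUpTo (λ x → x) (a +_) (suc b ∸ a)) (applyUpTo-segment a (suc b ∸ a) (λ _ → refl))

segment-All⁺ : ∀ {P : Pred ℕ 0ℓ} a c → (∀ h → a ≤ h → h < a + c → P h) → All P (segment a c)
segment-All⁺ a zero    _   = []
segment-All⁺ a (suc c) P[h] =
  P[h] a ≤-refl (m<m+n a z<s) ∷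
  segment-All⁺ (suc a) c (λ h a<h h<1+a+c → P[h] h (<⇒≤ a<h) (subst (h <_) (sym (+-suc a c)) h<1+a+c))

map-segment-cong : ∀ {F G : ℕ → ℕ} a c → (∀ h → a ≤ h → h < a + c → F h ≡ G h) → map F (segment a c) ≡ map G (segment a c)
map-segment-cong a c F≗G = map-cong-local (segment-All⁺ a c F≗G)

map-+-segment : ∀ b a c → map (b +_) (segment a c) ≡ segment (b + a) c
map-+-segment b a zero    = refl
map-+-segment b a (suc c) = cong (b + a ∷_) (trans (map-+-segment b (suc a) c) (cong (λ x → segment x c) (+-suc b a)))

map-reflect-segment : ∀ {F : ℕ → ℕ} a b c → (∀ h → a ≤ h → h < a + c → F h + suc h ≡ b + c + a) →
                      map F (segment a c) ≡ applyDownFrom (b +_) c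
map-reflect-segment a b zero    _  = refl
map-reflect-segment {F} a b (suc c) F+h =
  cong₂ _∷_ F[a]
    (map-reflect-segment (suc a) b c (λ h a<h h<1+a+c →
      trans (F+h h (<⇒≤ a<h) (subst (h <_) (sym (+-suc a c)) h<1+a+c)) (shift b c a)))
  where
  shift : ∀ b c a → b + suc c + a ≡ b + c + suc a
  shift = solve-∀
  F[a] : F a ≡ b + c
  F[a] = +-cancelʳ-≡ (suc a) (F a) (b + c) (trans (F+h a ≤-refl (m<m+n a z<s)) (shift b c a))

segment-interval : ∀ a c → segment (suc a) c ≡ interval (1 + a) (c + a)
segment-interval a c = sym (trans (interval-segment (suc a) (c + a)) (cong (segment (suc a)) (m+n∸n≡m c a)))

segment-∷ʳ : ∀ a c → segment a (suc c) ≡ segment a c ∷ʳ (a + c)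
segment-∷ʳ a c = trans (cong (segment a) (+-comm 1 c)) (segment-++ a c 1)

map-segment-rotate-↭ : ∀ {F G : ℕ → ℕ} c → F c ≡ G 1 → (∀ h → 1 ≤ h → h < c → F h ≡ G (suc h)) →
                       map F (segment 1 c) ↭ map G (segment 1 c)
map-segment-rotate-↭ zero     _      _ = ↭-refl
map-segment-rotate-↭ {F} {G} (suc c) last≡ F≗G∘suc = begin
  map F (segment 1 (suc c))          ≡⟨ cong (map F) (segment-∷ʳ 1 c) ⟩
  map F (segment 1 c ∷ʳ suc c)       ≡⟨ map-++ F (segment 1 c) [ suc c ] ⟩
  map F (segment 1 c) ∷ʳ F (suc c)   ≡⟨ cong₂ _∷ʳ_ (map-segment-cong 1 c F≗G∘suc) last≡ ⟩
  map (G ∘ suc) (segment 1 c) ∷ʳ G 1 ↭⟨ ∷↭∷ʳ (G 1) _ ⟨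
  G 1 ∷ map (G ∘ suc) (segment 1 c)  ≡⟨ cong (G 1 ∷_) (trans (map-∘ (segment 1 c)) (cong (map G) (map-+-segment 1 1 c))) ⟩
  map G (segment 1 (suc c))          ∎
  where open PermutationReasoning

applyDownFrom-↭-segment : ∀ b c → applyDownFrom (b +_) c ↭ segment b c
applyDownFrom-↭-segment b c = ↭-trans
  (↭-reflexive (trans (sym (reverse-applyUpTo (b +_) c)) (cong reverse (applyUpTo-segment b c (λ _ → refl)))))
  (↭-reverse (segment b c))

segment-split : ∀ a ℓ m L → ℓ + m ≤ L →
  segment a L ≡ segment a ℓ ++ segment (a + ℓ) m ++ segment (a + ℓ + m) (L ∸ (ℓ + m))
segment-split a ℓ m L ℓ+m≤L = begin
  segment a L                                                           ≡⟨ cong (segment a) (sym (m+[n∸m]≡n ℓ+m≤L)) ⟩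
  segment a (ℓ + m + rest)                                              ≡⟨ cong (segment a) (+-assoc ℓ m rest) ⟩
  segment a (ℓ + (m + rest))                                            ≡⟨ segment-++ a ℓ (m + rest) ⟩
  segment a ℓ ++ segment (a + ℓ) (m + rest)                             ≡⟨ cong (segment a ℓ ++_) (segment-++ (a + ℓ) m rest) ⟩
  segment a ℓ ++ segment (a + ℓ) m ++ segment (a + ℓ + m) rest          ∎
  where
  open ≡-Reasoning
  rest = L ∸ (ℓ + m)

module _ {A : Set} {P : Pred A 0ℓ} (P? : Decidable P) where

  count : List A → ℕ
  count xs = length (filter P? xs)

  count-++ : ∀ xs ys → count (xs ++ ys) ≡ count xs + count ys
  count-++ xs ys = trans (cong length (filter-++ P? xs ys)) (length-++ (filter P? xs))

  count-all : ∀ {xs} → All P xs → count xs ≡ length xs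
  count-all = cong length ∘ filter-all P?

  count-none : ∀ {xs} → All (∁ P) xs → count xs ≡ 0
  count-none = cong length ∘ filter-none P?

  count-map : ∀ {B : Set} (φ : B → A) (xs : List B) → count (map φ xs) ≡ length (filter (P? ∘ φ) xs)
  count-map φ []       = refl
  count-map φ (x ∷ xs) with P? (φ x)
  ... | yes _ = cong suc (count-map φ xs)
  ... | no  _ = count-map φ xs

module _ {A : Set} {P Q : Pred A 0ℓ} (P? : Decidable P) (Q? : Decidable Q) where
  open ≡-Reasoning

  count-filter : ∀ xs → count Q? (filter P? xs) ≡ count (P? ∩? Q?) xs
  count-filter []       = refl
  count-filter (x ∷ xs) = by-cases (P? x) (Q? x)
    where
    by-cases : Dec (P x) → Dec (Q x) → count Q? (filter P? (x ∷ xs)) ≡ count (P? ∩? Q?) (x ∷ xs)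
    by-cases (yes p) (yes q) = begin
      count Q? (filter P? (x ∷ xs))     ≡⟨ cong (count Q?) (filter-accept P? p) ⟩
      count Q? (x ∷ filter P? xs)       ≡⟨ cong length (filter-accept Q? q) ⟩
      suc (count Q? (filter P? xs))     ≡⟨ cong suc (count-filter xs) ⟩
      suc (count (P? ∩? Q?) xs)         ≡⟨ cong length (filter-accept (P? ∩? Q?) (p , q)) ⟨
      count (P? ∩? Q?) (x ∷ xs)         ∎
    by-cases (yes p) (no ¬q) = begin
      count Q? (filter P? (x ∷ xs))     ≡⟨ cong (count Q?) (filter-accept P? p) ⟩
      count Q? (x ∷ filter P? xs)       ≡⟨ cong length (filter-reject Q? ¬q) ⟩
      count Q? (filter P? xs)           ≡⟨ count-filter xs ⟩
      count (P? ∩? Q?) xs               ≡⟨ cong length (filter-reject (P? ∩? Q?) (¬q ∘ proj₂)) ⟨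
      count (P? ∩? Q?) (x ∷ xs)         ∎
    by-cases (no ¬p) _ = begin
      count Q? (filter P? (x ∷ xs))     ≡⟨ cong (count Q?) (filter-reject P? ¬p) ⟩
      count Q? (filter P? xs)           ≡⟨ count-filter xs ⟩
      count (P? ∩? Q?) xs               ≡⟨ cong length (filter-reject (P? ∩? Q?) (¬p ∘ proj₁)) ⟨
      count (P? ∩? Q?) (x ∷ xs)         ∎

module _ {P : Pred ℕ 0ℓ} (P? : Decidable P) (a ℓ m L : ℕ) (ℓ+m≤L : ℓ + m ≤ L) where
  private
    rest : ℕ
    rest = L ∸ (ℓ + m)

    count-split : count P? (segment a L) ≡
                  count P? (segment a ℓ) + (count P? (segment (a + ℓ) m) + count P? (segment (a + ℓ + m) rest))
    count-split = begin
      count P? (segment a L)                                          ≡⟨ cong (count P?) (segment-split a ℓ m L ℓ+m≤L) ⟩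
      count P? (segment a ℓ ++ segment (a + ℓ) m ++ _)                 ≡⟨ count-++ P? (segment a ℓ) _ ⟩
      count P? (segment a ℓ) + count P? (segment (a + ℓ) m ++ _)       ≡⟨ cong (count P? (segment a ℓ) +_) (count-++ P? (segment (a + ℓ) m) _) ⟩
      count P? (segment a ℓ) + (count P? (segment (a + ℓ) m) + count P? (segment (a + ℓ + m) rest)) ∎
      where open ≡-Reasoning

    end≡a+L : a + ℓ + m + rest ≡ a + L
    end≡a+L = trans (+-assoc (a + ℓ) m rest) (trans (+-assoc a ℓ (m + rest))
                (cong (a +_) (trans (sym (+-assoc ℓ m rest)) (m+[n∸m]≡n ℓ+m≤L))))

  count-segment-≥ : (∀ h → a + ℓ ≤ h → h < a + ℓ + m → P h) → m ≤ count P? (segment a L)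
  count-segment-≥ P-inside = begin
    m                                     ≡⟨ trans (count-all P? (segment-All⁺ (a + ℓ) m P-inside)) (length-segment (a + ℓ) m) ⟨
    count P? (segment (a + ℓ) m)          ≤⟨ m≤n+m _ (count P? (segment a ℓ)) ⟩
    count P? (segment a ℓ) + count P? (segment (a + ℓ) m)
                                          ≤⟨ +-monoʳ-≤ (count P? (segment a ℓ)) (m≤m+n _ _) ⟩
    count P? (segment a ℓ) + (count P? (segment (a + ℓ) m) + count P? (segment (a + ℓ + m) rest))
                                          ≡⟨ count-split ⟨
    count P? (segment a L)                ∎
    where open ≤-Reasoning

  count-segment-≤ : (∀ h → a ≤ h → h < a + L → P h → a + ℓ ≤ h × h < a + ℓ + m) → count P? (segment a L) ≤ m
  count-segment-≤ only-inside = begin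
    count P? (segment a L)                                      ≡⟨ count-split ⟩
    count P? (segment a ℓ) + (count P? (segment (a + ℓ) m) + _) ≡⟨ cong₂ (λ x y → x + (count P? (segment (a + ℓ) m) + y)) below above ⟩
    count P? (segment (a + ℓ) m) + 0                            ≡⟨ +-identityʳ _ ⟩
    count P? (segment (a + ℓ) m)                                ≤⟨ length-filter P? (segment (a + ℓ) m) ⟩
    length (segment (a + ℓ) m)                                  ≡⟨ length-segment (a + ℓ) m ⟩
    m                                                           ∎
    where
    open ≤-Reasoning
    below : count P? (segment a ℓ) ≡ 0
    below = count-none P? (segment-All⁺ a ℓ λ h a≤h h<a+ℓ Ph →
      <⇒≱ h<a+ℓ (proj₁ (only-inside h a≤h (<-≤-trans h<a+ℓ (+-monoʳ-≤ a (m+n≤o⇒m≤o ℓ ℓ+m≤L))) Ph)))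
    above : count P? (segment (a + ℓ + m) rest) ≡ 0
    above = count-none P? (segment-All⁺ (a + ℓ + m) rest λ h ≤h h<end Ph →
      <⇒≱ (proj₂ (only-inside h (≤-trans (≤-trans (m≤m+n a ℓ) (m≤m+n (a + ℓ) m)) ≤h) (subst (h <_) end≡a+L h<end) Ph)) ≤h)

module _ {P : Pred ℕ 0ℓ} (P? : Decidable P) {a L : ℕ} where

  count-segment-none : (∀ h → a ≤ h → h < a + L → ¬ P h) → count P? (segment a L) ≡ 0
  count-segment-none = count-none P? ∘ segment-All⁺ a L

  count-segment-unique : ∀ {v} → a ≤ v → v < a + L → P v → (∀ h → P h → h ≡ v) → count P? (segment a L) ≡ 1
  count-segment-unique {v} a≤v v<a+L Pv unique = ≤-antisym
    (count-segment-≤ P? a ℓ 1 L ℓ+1≤L λ h _ _ Ph →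
      subst (λ h → a + ℓ ≤ h × h < a + ℓ + 1) (sym (unique h Ph)) (≤-reflexive a+ℓ≡v , ≤-reflexive (sym a+ℓ+1≡1+v)))
    (count-segment-≥ P? a ℓ 1 L ℓ+1≤L λ h a+ℓ≤h h<a+ℓ+1 →
      subst P (≤-antisym (subst (_≤ h) a+ℓ≡v a+ℓ≤h) (≤-pred (subst (h <_) a+ℓ+1≡1+v h<a+ℓ+1))) Pv)
    where
    ℓ = v ∸ a
    a+ℓ≡v : a + ℓ ≡ v
    a+ℓ≡v = m+[n∸m]≡n a≤v
    a+ℓ+1≡1+v : a + ℓ + 1 ≡ suc v
    a+ℓ+1≡1+v = trans (+-comm (a + ℓ) 1) (cong suc a+ℓ≡v)
    ℓ+1≤L : ℓ + 1 ≤ L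
    ℓ+1≤L = subst (_≤ L) (+-comm 1 ℓ) (+-cancelˡ-< a ℓ L (subst (_< a + L) (sym a+ℓ≡v) v<a+L))

count-cartesianProduct : ∀ {A B : Set} {P : Pred (A × B) 0ℓ} {Q : Pred A 0ℓ} (P? : Decidable P) (Q? : Decidable Q) xs ys →
  All (λ x → length (filter (P? ∘ (x ,_)) ys) ≡ count Q? [ x ]) xs →
  count P? (cartesianProduct xs ys) ≡ count Q? xs
count-cartesianProduct P? Q? []       ys []           = refl
count-cartesianProduct P? Q? (x ∷ xs) ys (row≡ ∷ rows≡) = begin
  count P? (map (x ,_) ys ++ cartesianProduct xs ys)          ≡⟨ count-++ P? (map (x ,_) ys) _ ⟩
  count P? (map (x ,_) ys) + count P? (cartesianProduct xs ys) ≡⟨ cong₂ _+_ (trans (count-map P? (x ,_) ys) row≡)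
                                                                           (count-cartesianProduct P? Q? xs ys rows≡) ⟩
  count Q? [ x ] + count Q? xs                                ≡⟨ count-++ Q? [ x ] xs ⟨
  count Q? (x ∷ xs)                                           ∎
  where open ≡-Reasoning

private
  ≡ᵇ-refl : ∀ h → (h ≡ᵇ h) ≡ true
  ≡ᵇ-refl zero    = refl
  ≡ᵇ-refl (suc h) = ≡ᵇ-refl h

  ≢⇒≡ᵇ-false : ∀ {h s} → h ≢ s → (h ≡ᵇ s) ≡ false
  ≢⇒≡ᵇ-false {h} {s} h≢s = ¬-not (λ eq → h≢s (≡ᵇ⇒≡ h s (Equivalence.from T-≡ eq)))

swapAt-here : ∀ s → swapAt s s ≡ suc s
swapAt-here s rewrite ≡ᵇ-refl s = refl

swapAt-there : ∀ s → swapAt s (suc s) ≡ s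
swapAt-there s rewrite ≢⇒≡ᵇ-false (1+n≢n {s}) | ≡ᵇ-refl s = refl

swapAt-elsewhere : ∀ {s h} → h ≢ s → h ≢ suc s → swapAt s h ≡ h
swapAt-elsewhere h≢s h≢1+s rewrite ≢⇒≡ᵇ-false h≢s | ≢⇒≡ᵇ-false h≢1+s = refl

run : State → List Letter → State
run = foldl step

redOrigin blueOrigin : List Letter → ℕ → ℕ
redOrigin []        h = h
redOrigin (e s ∷ w) h = swapAt s (redOrigin w h)
redOrigin (f s ∷ w) h = redOrigin w h
blueOrigin []        h = h
blueOrigin (e s ∷ w) h = blueOrigin w h
blueOrigin (f s ∷ w) h = swapAt s (blueOrigin w h)

red-run : ∀ w st h → red (run st w) h ≡ red st (redOrigin w h)
red-run []        st h = refl
red-run (e s ∷ w) st h = red-run w (step st (e s)) h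
red-run (f s ∷ w) st h = red-run w (step st (f s)) h

blue-run : ∀ w st h → blue (run st w) h ≡ blue st (blueOrigin w h)
blue-run []        st h = refl
blue-run (e s ∷ w) st h = blue-run w (step st (e s)) h
blue-run (f s ∷ w) st h = blue-run w (step st (f s)) h

redDescent : ℕ → List Letter
redDescent K = map e (applyDownFrom suc K)

blueAscent : ℕ → ℕ → List Letter
blueAscent a c = map f (segment a c)

blueOrigin-redDescent : ∀ K h → blueOrigin (redDescent K) h ≡ h
blueOrigin-redDescent zero    h = refl
blueOrigin-redDescent (suc K) h = blueOrigin-redDescent K h

redOrigin-blueAscent : ∀ a c h → redOrigin (blueAscent a c) h ≡ h
redOrigin-blueAscent a zero    h = refl
redOrigin-blueAscent a (suc c) h = redOrigin-blueAscent (suc a) c h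

redOrigin-descent-above : ∀ K h → suc K < h → redOrigin (redDescent K) h ≡ h
redOrigin-descent-above zero    h _     = refl
redOrigin-descent-above (suc K) h 2+K<h =
  trans (cong (swapAt (suc K)) (redOrigin-descent-above K h (<-trans (n<1+n _) 2+K<h)))
        (swapAt-elsewhere (>⇒≢ (<-trans (n<1+n _) 2+K<h)) (>⇒≢ 2+K<h))

redOrigin-descent-bottom : ∀ K → redOrigin (redDescent K) 1 ≡ suc K
redOrigin-descent-bottom zero    = refl
redOrigin-descent-bottom (suc K) = trans (cong (swapAt (suc K)) (redOrigin-descent-bottom K)) (swapAt-here (suc K))

redOrigin-descent-shift : ∀ K h → 1 ≤ h → h ≤ K → redOrigin (redDescent K) (suc h) ≡ h
redOrigin-descent-shift zero    (suc h) _ ()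
redOrigin-descent-shift (suc K) h 1≤h h≤1+K with m≤n⇒m<n∨m≡n h≤1+K
... | inj₂ refl = trans (cong (swapAt h) (redOrigin-descent-above K (suc h) ≤-refl)) (swapAt-there h)
... | inj₁ h<1+K = trans (cong (swapAt (suc K)) (redOrigin-descent-shift K h 1≤h (≤-pred h<1+K)))
                         (swapAt-elsewhere (<⇒≢ h<1+K) (<⇒≢ (<-trans h<1+K (n<1+n _))))

blueOrigin-ascent-below : ∀ a c h → h < a → blueOrigin (blueAscent a c) h ≡ h
blueOrigin-ascent-below a zero    h _   = refl
blueOrigin-ascent-below a (suc c) h h<a =
  trans (cong (swapAt a) (blueOrigin-ascent-below (suc a) c h (<-trans h<a (n<1+n a))))
        (swapAt-elsewhere (<⇒≢ h<a) (<⇒≢ (<-trans h<a (n<1+n a))))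

blueOrigin-ascent-above : ∀ a c h → a + c < h → blueOrigin (blueAscent a c) h ≡ h
blueOrigin-ascent-above a zero    h _     = refl
blueOrigin-ascent-above a (suc c) h a+c<h =
  trans (cong (swapAt a) (blueOrigin-ascent-above (suc a) c h (subst (_< h) (+-suc a c) a+c<h)))
        (swapAt-elsewhere (>⇒≢ (≤-<-trans (m≤m+n a (suc c)) a+c<h))
                          (>⇒≢ (≤-<-trans (subst (suc a ≤_) (sym (+-suc a c)) (s≤s (m≤m+n a c))) a+c<h)))

blueOrigin-ascent-top : ∀ a c → blueOrigin (blueAscent a c) (a + c) ≡ a
blueOrigin-ascent-top a zero    = +-identityʳ a
blueOrigin-ascent-top a (suc c) = begin
  swapAt a (blueOrigin (blueAscent (suc a) c) (a + suc c))  ≡⟨ cong (swapAt a ∘ blueOrigin (blueAscent (suc a) c)) (+-suc a c) ⟩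
  swapAt a (blueOrigin (blueAscent (suc a) c) (suc a + c))  ≡⟨ cong (swapAt a) (blueOrigin-ascent-top (suc a) c) ⟩
  swapAt a (suc a)                                          ≡⟨ swapAt-there a ⟩
  a                                                         ∎
  where open ≡-Reasoning

blueOrigin-ascent-shift : ∀ a c h → a ≤ h → h < a + c → blueOrigin (blueAscent a c) h ≡ suc h
blueOrigin-ascent-shift a zero    h a≤h h<a+0 = ⊥-elim (<⇒≱ h<a+0 (subst (_≤ h) (sym (+-identityʳ a)) a≤h))
blueOrigin-ascent-shift a (suc c) h a≤h h<a+1+c with m≤n⇒m<n∨m≡n a≤h
... | inj₂ refl = trans (cong (swapAt a) (blueOrigin-ascent-below (suc a) c a (n<1+n a))) (swapAt-here a)
... | inj₁ a<h  = trans (cong (swapAt a) (blueOrigin-ascent-shift (suc a) c h a<h (subst (h <_) (+-suc a c) h<a+1+c)))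
                        (swapAt-elsewhere (>⇒≢ (<-trans a<h (n<1+n h))) (>⇒≢ (s≤s a<h)))

-- Crossings in one track

sameMinor-trans : ∀ {L M R} → SameMinor L M → SameMinor M R → SameMinor L R
sameMinor-trans (r₁ , b₁) (r₂ , b₂) = ↭-trans r₁ r₂ , ↭-trans b₁ b₂

module _ (t : ℕ) where

  afterTrackCrossings-++ : ∀ st u v → afterTrackCrossings t st (u ++ v) ≡ afterTrackCrossings t st u ++ afterTrackCrossings t (run st u) v
  afterTrackCrossings-++ st []      v = refl
  afterTrackCrossings-++ st (x ∷ u) v with inTrack t x
  ... | true  = cong (step st x ∷_) (afterTrackCrossings-++ (step st x) u v)
  ... | false = afterTrackCrossings-++ (step st x) u v

  private
    cross : ∀ x st w → inTrack t x ≡ true → afterTrackCrossings t st (x ∷ w) ≡ step st x ∷ afterTrackCrossings t (step st x) w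
    cross x st w _ with inTrack t x
    cross x st w refl | true = refl

    pass : ∀ x st w → inTrack t x ≡ false → afterTrackCrossings t st (x ∷ w) ≡ afterTrackCrossings t (step st x) w
    pass x st w _ with inTrack t x
    pass x st w refl | false = refl

  redDescent-no-crossing : ∀ K st → K < t → afterTrackCrossings t st (redDescent K) ≡ []
  redDescent-no-crossing zero    st _   = refl
  redDescent-no-crossing (suc K) st K<t =
    trans (pass (e (suc K)) st (redDescent K) (≢⇒≡ᵇ-false (<⇒≢ K<t))) (redDescent-no-crossing K _ (<-trans (n<1+n K) K<t))

  private
    redDescent-crossing-state : ∀ K st → 1 ≤ t → t ≤ K → Σ State λ stc →
        afterTrackCrossings t st (redDescent K) ≡ [ stc ] × (∀ h → h < t → red stc h ≡ red st h) ×
      red stc t ≡ red st (suc K) × blue stc ≡ blue st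
    redDescent-crossing-state zero    st 1≤t t≤0 = ⊥-elim (<⇒≱ 1≤t t≤0)
    redDescent-crossing-state (suc K) st 1≤t t≤1+K with m≤n⇒m<n∨m≡n t≤1+K
    ... | inj₂ refl = step st (e t) ,
      trans (cross (e t) st (redDescent K) (≡ᵇ-refl t)) (cong (step st (e t) ∷_) (redDescent-no-crossing K _ (n<1+n K))) ,
      (λ h h<t → cong (red st) (swapAt-elsewhere (<⇒≢ h<t) (<⇒≢ (<-trans h<t (n<1+n t))))) ,
      cong (red st) (swapAt-here t) , refl
    ... | inj₁ t<1+K with redDescent-crossing-state K (step st (e (suc K))) 1≤t (≤-pred t<1+K)
    ... | stc , ≡[stc] , below , at , blue≡ = stc ,
      trans (pass (e (suc K)) st (redDescent K) (≢⇒≡ᵇ-false (>⇒≢ t<1+K))) ≡[stc] ,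
      (λ h h<t → trans (below h h<t) (cong (red st) (swapAt-elsewhere (<⇒≢ (<-trans h<t t<1+K)) (<⇒≢ (<-trans (<-trans h<t t<1+K) (n<1+n _)))))) ,
      trans at (cong (red st) (swapAt-here (suc K))) , blue≡

  blueAscent-no-crossing-below : ∀ a c st → a + c ≤ t → afterTrackCrossings t st (blueAscent a c) ≡ []
  blueAscent-no-crossing-below a zero    st _     = refl
  blueAscent-no-crossing-below a (suc c) st a+c≤t =
    trans (pass (f a) st (blueAscent (suc a) c) (≢⇒≡ᵇ-false (<⇒≢ (<-≤-trans (m<m+n a z<s) a+c≤t))))
          (blueAscent-no-crossing-below (suc a) c _ (subst (_≤ t) (+-suc a c) a+c≤t))

  private
    blueAscent-no-crossing-above : ∀ a c st → t < a → afterTrackCrossings t st (blueAscent a c) ≡ []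
    blueAscent-no-crossing-above a zero    st _   = refl
    blueAscent-no-crossing-above a (suc c) st t<a =
      trans (pass (f a) st (blueAscent (suc a) c) (≢⇒≡ᵇ-false (>⇒≢ t<a))) (blueAscent-no-crossing-above (suc a) c _ (<-trans t<a (n<1+n a)))

    blueAscent-crossing-state : ∀ a c st → a ≤ t → t < a + c → Σ State λ stc →
      afterTrackCrossings t st (blueAscent a c) ≡ [ stc ] × (∀ h → a ≤ h → h ≤ t → blue stc h ≡ blue st (suc h)) ×
      (∀ h → h < a → blue stc h ≡ blue st h) × red stc ≡ red st
    blueAscent-crossing-state a zero    st a≤t t<a+0 = ⊥-elim (<⇒≱ t<a+0 (subst (_≤ t) (sym (+-identityʳ a)) a≤t))
    blueAscent-crossing-state a (suc c) st a≤t t<a+1+c with m≤n⇒m<n∨m≡n a≤t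
    ... | inj₂ refl = step st (f a) ,
      trans (cross (f a) st (blueAscent (suc a) c) (≡ᵇ-refl a)) (cong (step st (f a) ∷_) (blueAscent-no-crossing-above (suc a) c _ (n<1+n a))) ,
      (λ h a≤h h≤a → cong (blue st) (trans (cong (swapAt a) (≤-antisym h≤a a≤h)) (trans (swapAt-here a) (cong suc (≤-antisym a≤h h≤a))))) ,
      (λ h h<a → cong (blue st) (swapAt-elsewhere (<⇒≢ h<a) (<⇒≢ (<-trans h<a (n<1+n a))))) ,
      refl
    ... | inj₁ a<t with blueAscent-crossing-state (suc a) c (step st (f a)) a<t (subst (t <_) (+-suc a c) t<a+1+c)
    ... | stc , ≡[stc] , shifted , below , red≡ = stc ,
      trans (pass (f a) st (blueAscent (suc a) c) (≢⇒≡ᵇ-false (<⇒≢ a<t))) ≡[stc] ,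
      shifted′ ,
      (λ h h<a → trans (below h (<-trans h<a (n<1+n a))) (cong (blue st) (swapAt-elsewhere (<⇒≢ h<a) (<⇒≢ (<-trans h<a (n<1+n a)))))) ,
      red≡
      where
      shifted′ : ∀ h → a ≤ h → h ≤ t → blue stc h ≡ blue st (suc h)
      shifted′ h a≤h h≤t with m≤n⇒m<n∨m≡n a≤h
      ... | inj₂ refl = trans (below h (n<1+n h)) (cong (blue st) (swapAt-here h))
      ... | inj₁ a<h  = trans (shifted h a<h h≤t) (cong (blue st) (swapAt-elsewhere (>⇒≢ (<-trans a<h (n<1+n h))) (>⇒≢ (s≤s a<h))))

  SameLabel : State → State → Set
  SameLabel st st′ = SameMinor (labelMinor t st) (labelMinor t st′)

  sameLabel : ∀ {st st′} → map (red st) (segment 1 t) ↭ map (red st′) (segment 1 t) →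
              map (blue st) (segment 1 t) ↭ map (blue st′) (segment 1 t) → SameLabel st st′
  sameLabel {st} {st′} redSets blueSets =
    subst (λ xs → SameMinor (minor (map (red st) xs) (map (blue st) xs)) (minor (map (red st′) xs) (map (blue st′) xs)))
          (sym (interval-segment 1 t)) (redSets , blueSets)

  -- Between the crossing and the end of the word only the red wires at heights 1, …, t are permuted.
  redDescent-crossing : ∀ K st → 1 ≤ t → t ≤ K → Σ State λ stc →
    afterTrackCrossings t st (redDescent K) ≡ [ stc ] × SameLabel stc (run st (redDescent K))
  redDescent-crossing K st 1≤t t≤K with redDescent-crossing-state K st 1≤t t≤K
  ... | stc , ≡[stc] , below , at , blue≡ = stc , ≡[stc] , sameLabel redSets blueSets
    where
    redSets : map (red stc) (segment 1 t) ↭ map (red (run st (redDescent K))) (segment 1 t)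
    redSets = map-segment-rotate-↭ t
      (trans at (sym (trans (red-run (redDescent K) st 1) (cong (red st) (redOrigin-descent-bottom K)))))
      (λ h 1≤h h<t → trans (below h h<t) (sym (trans (red-run (redDescent K) st (suc h))
                       (cong (red st) (redOrigin-descent-shift K h 1≤h (<⇒≤ (<-≤-trans h<t t≤K)))))))
    blueSets : map (blue stc) (segment 1 t) ↭ map (blue (run st (redDescent K))) (segment 1 t)
    blueSets = ↭-reflexive (map-segment-cong 1 t λ h _ _ →
      trans (cong-app blue≡ h) (sym (trans (blue-run (redDescent K) st h) (cong (blue st) (blueOrigin-redDescent K h)))))

  blueAscent-crossing : ∀ c st → 1 ≤ t → t ≤ c → Σ State λ stc →
    afterTrackCrossings t st (blueAscent 1 c) ≡ [ stc ] × SameLabel stc (run st (blueAscent 1 c))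
  blueAscent-crossing c st 1≤t t≤c with blueAscent-crossing-state 1 c st 1≤t (s≤s t≤c)
  ... | stc , ≡[stc] , shifted , _ , red≡ = stc , ≡[stc] , sameLabel redSets blueSets
    where
    redSets : map (red stc) (segment 1 t) ↭ map (red (run st (blueAscent 1 c))) (segment 1 t)
    redSets = ↭-reflexive (map-segment-cong 1 t λ h _ _ →
      trans (cong-app red≡ h) (sym (trans (red-run (blueAscent 1 c) st h) (cong (red st) (redOrigin-blueAscent 1 c h)))))
    blueSets : map (blue stc) (segment 1 t) ↭ map (blue (run st (blueAscent 1 c))) (segment 1 t)
    blueSets = ↭-reflexive (map-segment-cong 1 t λ h 1≤h h<1+t →
      trans (shifted h 1≤h (≤-pred h<1+t)) (sym (trans (blue-run (blueAscent 1 c) st h)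
        (cong (blue st) (blueOrigin-ascent-shift 1 c h 1≤h (s≤s (≤-trans (≤-pred h<1+t) t≤c)))))))

-- Tent arrangements

-- The wires y+1, …, N+1 occupy heights 1, …, N+1-y in increasing order, and y, …, 1 the heights above.
record Tent (N y : ℕ) (F : ℕ → ℕ) : Set where
  field
    rising  : ∀ h → 1 ≤ h → h + y ≤ suc N → F h ≡ y + h
    falling : ∀ h → suc N < h + y → h ≤ suc N → F h + h ≡ suc (suc N)
open Tent

tent-cong : ∀ {N y F G} → (∀ h → G h ≡ F h) → Tent N y F → Tent N y G
rising  (tent-cong G≗F T) h 1≤h h+y≤1+N = trans (G≗F h) (rising T h 1≤h h+y≤1+N)
falling (tent-cong G≗F T) h 1+N<h+y h≤1+N = trans (cong (_+ h) (G≗F h)) (falling T h 1+N<h+y h≤1+N)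

module _ {N : ℕ} where

  tent-initRed : Tent N N (red (initState (suc N)))
  rising  tent-initRed (suc zero)    _ _          = +-comm 1 N
  rising  tent-initRed (suc (suc h)) _ 2+h+N≤1+N  = ⊥-elim (<⇒≱ (s≤s (s≤s (m≤n+m N h))) 2+h+N≤1+N)
  falling tent-initRed h             _ h≤1+N      = m∸n+n≡m (m≤n⇒m≤1+n h≤1+N)

  tent-initBlue : Tent N 0 (blue (initState (suc N)))
  rising  tent-initBlue h _ _            = refl
  falling tent-initBlue h 1+N<h+0 h≤1+N = ⊥-elim (<⇒≱ 1+N<h+0 (subst (_≤ suc N) (sym (+-identityʳ h)) h≤1+N))

tent-redDescent : ∀ {N} K {a F} → K + a ≡ N → Tent N (suc a) F → Tent N a (F ∘ redOrigin (redDescent K))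
rising (tent-redDescent K {a} {F} refl T) (suc zero) _ _ =
  +-cancelʳ-≡ (suc K) _ _ (begin
    F (redOrigin (redDescent K) 1) + suc K   ≡⟨ cong (λ h → F h + suc K) (redOrigin-descent-bottom K) ⟩
    F (suc K) + suc K                        ≡⟨ falling T (suc K) (s≤s (≤-reflexive (sym (+-suc K a)))) (s≤s (m≤m+n K a)) ⟩
    suc (suc (K + a))                        ≡⟨ lemma K a ⟩
    a + 1 + suc K                            ∎)
  where
  open ≡-Reasoning
  lemma : ∀ K a → suc (suc (K + a)) ≡ a + 1 + suc K
  lemma = solve-∀
rising (tent-redDescent K {a} {F} refl T) (suc (suc h)) _ 2+h+a≤1+K+a = begin
  F (redOrigin (redDescent K) (suc (suc h)))   ≡⟨ cong F (redOrigin-descent-shift K (suc h) (s≤s z≤n) 1+h≤K) ⟩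
  F (suc h)                                    ≡⟨ rising T (suc h) (s≤s z≤n) (subst (_≤ suc (K + a)) (sym (+-suc (suc h) a)) 2+h+a≤1+K+a) ⟩
  suc a + suc h                                ≡⟨ sym (+-suc a (suc h)) ⟩
  a + suc (suc h)                              ∎
  where
  open ≡-Reasoning
  1+h≤K : suc h ≤ K
  1+h≤K = +-cancelʳ-≤ a (suc h) K (≤-pred 2+h+a≤1+K+a)
falling (tent-redDescent K {a} {F} refl T) h 1+K+a<h+a h≤1+K+a =
  trans (cong (λ h′ → F h′ + h) (redOrigin-descent-above K h (+-cancelʳ-< a (suc K) h 1+K+a<h+a)))
        (falling T h (<-≤-trans 1+K+a<h+a (+-monoʳ-≤ h (n≤1+n a))) h≤1+K+a)

tent-blueAscent : ∀ {N} c {g F} → c + g ≡ N → Tent N g F → Tent N (suc g) (F ∘ blueOrigin (blueAscent 1 c))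
rising (tent-blueAscent c {g} {F} refl T) h 1≤h h+1+g≤1+c+g = begin
  F (blueOrigin (blueAscent 1 c) h)  ≡⟨ cong F (blueOrigin-ascent-shift 1 c h 1≤h (s≤s h≤c)) ⟩
  F (suc h)                          ≡⟨ rising T (suc h) (s≤s z≤n) (subst (_≤ suc (c + g)) (+-suc h g) h+1+g≤1+c+g) ⟩
  g + suc h                          ≡⟨ +-suc g h ⟩
  suc g + h                          ∎
  where
  open ≡-Reasoning
  h≤c : h ≤ c
  h≤c = +-cancelʳ-≤ g h c (≤-pred (subst (_≤ suc (c + g)) (+-suc h g) h+1+g≤1+c+g))
falling (tent-blueAscent c {g} {F} refl T) h 1+c+g<h+1+g h≤1+c+g with m≤n⇒m<n∨m≡n c<h
  where
  c<h : c < h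
  c<h = +-cancelʳ-< (suc g) c h (subst (_< h + suc g) (sym (+-suc c g)) 1+c+g<h+1+g)
... | inj₂ refl = begin
  F (blueOrigin (blueAscent 1 c) (suc c)) + suc c  ≡⟨ cong (λ h′ → F h′ + suc c) (blueOrigin-ascent-top 1 c) ⟩
  F 1 + suc c                                      ≡⟨ cong (_+ suc c) (rising T 1 ≤-refl (s≤s (m≤n+m g c))) ⟩
  g + 1 + suc c                                    ≡⟨ lemma g c ⟩
  suc (suc (c + g))                                ∎
  where
  open ≡-Reasoning
  lemma : ∀ g c → g + 1 + suc c ≡ suc (suc (c + g))
  lemma = solve-∀
... | inj₁ 1+c<h =
  trans (cong (λ h′ → F h′ + h) (blueOrigin-ascent-above 1 c h 1+c<h))
        (falling T h (<-≤-trans (+-monoˡ-< g 1+c<h) ≤-refl) h≤1+c+g)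

tent-rising : ∀ {N y F} c → c + y ≤ suc N → Tent N y F → map F (segment 1 c) ≡ segment (suc y) c
tent-rising {N} {y} {F} c c+y≤1+N T = begin
  map F (segment 1 c)        ≡⟨ map-segment-cong 1 c (λ h 1≤h h<1+c → rising T h 1≤h (≤-trans (+-monoˡ-≤ y (≤-pred h<1+c)) c+y≤1+N)) ⟩
  map (y +_) (segment 1 c)   ≡⟨ map-+-segment y 1 c ⟩
  segment (y + 1) c          ≡⟨ cong (λ z → segment z c) (+-comm y 1) ⟩
  segment (suc y) c          ∎
  where open ≡-Reasoning

tent-falling : ∀ {N y F} x u → suc N ≡ x + y → x + u ≤ suc N → Tent N y F →
               map F (segment (suc x) u) ≡ applyDownFrom (suc (y ∸ u) +_) u
tent-falling {N} {y} {F} x u 1+N≡x+y x+u≤1+N T = map-reflect-segment (suc x) (suc (y ∸ u)) u λ h 1+x≤h h<1+x+u → begin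
  F h + suc h             ≡⟨ +-suc (F h) h ⟩
  suc (F h + h)           ≡⟨ cong suc (falling T h (subst (_< h + y) (sym 1+N≡x+y) (+-monoˡ-≤ y 1+x≤h))
                                                 (≤-trans (≤-pred h<1+x+u) x+u≤1+N)) ⟩
  suc (suc (suc N))       ≡⟨ cong (suc ∘ suc) 1+N≡x+y ⟩
  suc (suc (x + y))       ≡⟨ cong (λ z → suc (suc (x + z))) (m∸n+n≡m u≤y) ⟨
  suc (suc (x + (y ∸ u + u))) ≡⟨ lemma x (y ∸ u) u ⟩
  suc (y ∸ u) + u + suc x ∎
  where
  open ≡-Reasoning
  u≤y : u ≤ y
  u≤y = +-cancelˡ-≤ x u y (subst (x + u ≤_) 1+N≡x+y x+u≤1+N)
  lemma : ∀ x r u → suc (suc (x + (r + u))) ≡ suc r + u + suc x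
  lemma = solve-∀

module _ {N t s : ℕ} (t+s≡1+N : t + s ≡ suc N) where

  private
    tent-label-high : ∀ {y F} x u → suc N ≡ x + y → x + u ≡ t → Tent N y F → map F (segment 1 t) ↭ segment (suc s) t
    tent-label-high {y} {F} x u 1+N≡x+y x+u≡t T = begin
      map F (segment 1 t)                               ≡⟨ cong (map F ∘ segment 1) (sym x+u≡t) ⟩
      map F (segment 1 (x + u))                         ≡⟨ cong (map F) (segment-++ 1 x u) ⟩
      map F (segment 1 x ++ segment (suc x) u)          ≡⟨ map-++ F (segment 1 x) _ ⟩
      map F (segment 1 x) ++ map F (segment (suc x) u)  ≡⟨ cong₂ _++_ (tent-rising x (≤-reflexive (sym 1+N≡x+y)) T)
                                                                     (tent-falling x u 1+N≡x+y x+u≤1+N T) ⟩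
      segment (suc y) x ++ applyDownFrom (suc (y ∸ u) +_) u ≡⟨ cong (λ z → segment (suc y) x ++ applyDownFrom (suc z +_) u) y∸u≡s ⟩
      segment (suc y) x ++ applyDownFrom (suc s +_) u   ↭⟨ ++⁺ˡ (segment (suc y) x) (applyDownFrom-↭-segment (suc s) u) ⟩
      segment (suc y) x ++ segment (suc s) u            ↭⟨ ++-comm (segment (suc y) x) _ ⟩
      segment (suc s) u ++ segment (suc y) x            ≡⟨ cong (λ z → segment (suc s) u ++ segment (suc z) x) s+u≡y ⟨
      segment (suc s) u ++ segment (suc s + u) x        ≡⟨ segment-++ (suc s) u x ⟨
      segment (suc s) (u + x)                           ≡⟨ cong (segment (suc s)) (trans (+-comm u x) x+u≡t) ⟩
      segment (suc s) t                                 ∎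
      where
      open PermutationReasoning
      x+u≤1+N : x + u ≤ suc N
      x+u≤1+N = subst (_≤ suc N) (sym x+u≡t) (subst (t ≤_) t+s≡1+N (m≤m+n t s))
      s+u≡y : s + u ≡ y
      s+u≡y = +-cancelˡ-≡ x (s + u) y (trans (lemma x s u) (trans (cong (_+ s) x+u≡t) (trans t+s≡1+N 1+N≡x+y)))
        where
        lemma : ∀ x s u → x + (s + u) ≡ x + u + s
        lemma = solve-∀
      y∸u≡s : y ∸ u ≡ s
      y∸u≡s = trans (cong (_∸ u) (sym s+u≡y)) (m+n∸n≡m s u)

  tent-label : ∀ {y F} → y ≤ N → Tent N y F → map F (segment 1 t) ↭ segment (suc (y ⊓ s)) t
  tent-label {y} y≤N T with t + y ≤? suc N
  ... | yes t+y≤1+N = subst (λ z → _ ↭ segment (suc z) t) (sym (m≤n⇒m⊓n≡m y≤s)) (↭-reflexive (tent-rising t t+y≤1+N T))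
    where
    y≤s : y ≤ s
    y≤s = +-cancelˡ-≤ t y s (subst (t + y ≤_) (sym t+s≡1+N) t+y≤1+N)
  ... | no  t+y≰1+N = subst (λ z → _ ↭ segment (suc z) t) (sym (m≥n⇒m⊓n≡n (<⇒≤ s<y)))
                        (tent-label-high x (t ∸ x) (sym (m∸n+n≡m (m≤n⇒m≤1+n y≤N))) (m+[n∸m]≡n x≤t) T)
    where
    s<y : s < y
    s<y = +-cancelˡ-< t s y (subst (_< t + y) (sym t+s≡1+N) (≰⇒> t+y≰1+N))
    x = suc N ∸ y
    x≤t : x ≤ t
    x≤t = +-cancelʳ-≤ y x t (subst (_≤ t + y) (sym (m∸n+n≡m (m≤n⇒m≤1+n y≤N))) (<⇒≤ (≰⇒> t+y≰1+N)))

-- Boxes on the diagonals of Y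

module _ {N : ℕ} (Y : Young (suc N)) where

  row-antitone : ∀ i j → 1 ≤ i → i ≤ j → j ≤ N → row Y j ≤ row Y i
  row-antitone i j 1≤i i≤j j≤N with m≤n⇒m<n∨m≡n i≤j
  row-antitone i j       1≤i i≤j j≤N | inj₂ refl = ≤-refl
  row-antitone i (suc j) 1≤i i≤j j≤N | inj₁ i<1+j =
    ≤-trans (weaklyDec Y j (≤-trans 1≤i (≤-pred i<1+j)) j≤N) (row-antitone i j 1≤i (≤-pred i<1+j) (≤-trans (n≤1+n j) j≤N))

  private
    InY? : Decidable (λ (p : ℕ × ℕ) → proj₂ p ≤ row Y (proj₁ p))
    InY? p = proj₂ p ≤? row Y (proj₁ p)

    count-boxes : ∀ {E : Pred (ℕ × ℕ) 0ℓ} (E? : Decidable E) {Q : Pred ℕ 0ℓ} (Q? : Decidable Q) →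
      (∀ x → 1 ≤ x → x < 1 + N → length (filter ((InY? ∩? E?) ∘ (x ,_)) (segment 1 N)) ≡ count Q? [ x ]) →
      count E? (boxes (suc N) Y) ≡ count Q? (segment 1 N)
    count-boxes E? Q? perRow = begin
      count E? (filter InY? (cartesianProduct indices indices))   ≡⟨ count-filter InY? E? (cartesianProduct indices indices) ⟩
      count (InY? ∩? E?) (cartesianProduct indices indices)       ≡⟨ cong (λ xs → count (InY? ∩? E?) (cartesianProduct xs xs)) (interval-segment 1 N) ⟩
      count (InY? ∩? E?) (cartesianProduct (segment 1 N) (segment 1 N))
                                                                  ≡⟨ count-cartesianProduct (InY? ∩? E?) Q? _ _ (segment-All⁺ 1 N perRow) ⟩
      count Q? (segment 1 N)                                      ∎
      where
      open ≡-Reasoning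
      indices = interval 1 (suc N ∸ 1)

  boxesAbove≡count : ∀ d → boxesAbove (suc N) Y d ≡ count (λ x → x + d ≤? row Y x) (segment 1 N)
  boxesAbove≡count d = count-boxes OnDiagonal? HasBox? boxInRow
    where
    OnDiagonal? : Decidable (λ (p : ℕ × ℕ) → proj₂ p ≡ proj₁ p + d)
    OnDiagonal? p = proj₂ p ≟ proj₁ p + d
    HasBox? = λ x → x + d ≤? row Y x
    boxInRow : ∀ x → 1 ≤ x → x < 1 + N → length (filter ((InY? ∩? OnDiagonal?) ∘ (x ,_)) (segment 1 N)) ≡ count HasBox? [ x ]
    boxInRow x 1≤x x<1+N with HasBox? x
    ... | yes x+d≤row = trans
      (count-segment-unique ((InY? ∩? OnDiagonal?) ∘ (x ,_)) {1} {N} (≤-trans 1≤x (m≤m+n x d))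
        (s≤s (≤-trans x+d≤row (bounded Y x 1≤x (≤-pred x<1+N)))) (x+d≤row , refl) (λ _ → proj₂))
      (sym (cong length (filter-accept HasBox? x+d≤row)))
    ... | no  x+d≰row = trans
      (count-segment-none ((InY? ∩? OnDiagonal?) ∘ (x ,_)) {1} {N} λ { c _ _ (c≤row , refl) → x+d≰row c≤row })
      (sym (cong length (filter-reject HasBox? x+d≰row)))

  boxesBelow≡count : ∀ d → boxesBelow (suc N) Y d ≡ count (λ x → (d <? x) ×-dec (x ≤? row Y x + d)) (segment 1 N)
  boxesBelow≡count d = count-boxes OnDiagonal? HasBox? boxInRow
    where
    OnDiagonal? : Decidable (λ (p : ℕ × ℕ) → proj₁ p ≡ proj₂ p + d)
    OnDiagonal? p = proj₁ p ≟ proj₂ p + d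
    HasBox? = λ x → (d <? x) ×-dec (x ≤? row Y x + d)
    boxInRow : ∀ x → 1 ≤ x → x < 1 + N → length (filter ((InY? ∩? OnDiagonal?) ∘ (x ,_)) (segment 1 N)) ≡ count HasBox? [ x ]
    boxInRow x 1≤x x<1+N with HasBox? x
    ... | yes (d<x , x≤row+d) = trans
      (count-segment-unique ((InY? ∩? OnDiagonal?) ∘ (x ,_)) {1} {N} (m<n⇒0<n∸m d<x)
        (s≤s (≤-trans c≤row (bounded Y x 1≤x (≤-pred x<1+N)))) (c≤row , sym (m∸n+n≡m (<⇒≤ d<x)))
        (λ c (_ , x≡c+d) → trans (sym (m+n∸n≡m c d)) (cong (_∸ d) (sym x≡c+d))))
      (sym (cong length (filter-accept HasBox? (d<x , x≤row+d))))
      where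
      c≤row : x ∸ d ≤ row Y x
      c≤row = m≤n+o⇒m∸n≤o x d (subst (x ≤_) (+-comm (row Y x) d) x≤row+d)
    ... | no  ¬Qx = trans
      (count-segment-none ((InY? ∩? OnDiagonal?) ∘ (x ,_)) {1} {N} λ { c 1≤c _ (c≤row , refl) →
        ¬Qx (+-monoˡ-≤ d 1≤c , +-monoˡ-≤ d c≤row) })
      (sym (cong length (filter-reject HasBox? ¬Qx)))

-- The word D(Y)

reverse-interval : ∀ K → reverse (interval 1 K) ≡ applyDownFrom suc K
reverse-interval K = trans (cong reverse (map-applyUpTo (λ x → x) suc K)) (reverse-applyUpTo suc K)

redWord-descent : ∀ N a → redWord (suc N) (suc a) ≡ redDescent (N ∸ a)
redWord-descent N a = cong (map e) (reverse-interval (N ∸ a))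

gapBlue-ascent : ∀ {N g} → g < N → gapBlue (suc N) g ≡ blueAscent 1 (N ∸ g)
gapBlue-ascent {N} {g} g<N = begin
  (if suc g ≤ᵇ N then blueWord (suc N) (suc g) else [])   ≡⟨ cong (if_then blueWord (suc N) (suc g) else []) (≤ᵇ-true g<N) ⟩
  map f (interval 1 (N ∸ g))                              ≡⟨ cong (map f) (interval-segment 1 (N ∸ g)) ⟩
  blueAscent 1 (N ∸ g)                                    ∎
  where open ≡-Reasoning

module _ {N : ℕ} (Y : Young (suc N)) where

  redsInGap : ℕ → ℕ → List Letter
  redsInGap a g = concatMap (redWord (suc N)) (filter (λ j → row Y j ≟ g) (applyDownFrom suc a))

  -- the end of D(Y) from gap g on, once the red words r_{a+1}, …, r_N have been read
  remaining : ℕ → ℕ → ℕ → List Letter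
  remaining a g r = concatMap (λ g′ → redsInGap a g′ ++ gapBlue (suc N) g′) (segment g (suc r))

  DY≡remaining : DY (suc N) Y ≡ remaining N 0 N
  DY≡remaining = cong₂ (λ js gs → concatMap (λ g → concatMap (redWord (suc N)) (filter (λ j → row Y j ≟ g) js) ++ gapBlue (suc N) g) gs)
                       (reverse-interval N) (applyUpTo-segment 0 (suc N) (λ _ → refl))

  remaining-red : ∀ {a g} r → row Y (suc a) ≡ g → remaining (suc a) g r ≡ redWord (suc N) (suc a) ++ remaining a g r
  remaining-red {a} {g} r row≡g = begin
    (redsInGap (suc a) g ++ gapBlue (suc N) g) ++ later (suc a)              ≡⟨ cong₂ (λ rs l → (rs ++ gapBlue (suc N) g) ++ l) here-accept later-reject ⟩
    ((redWord (suc N) (suc a) ++ redsInGap a g) ++ gapBlue (suc N) g) ++ later a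
                                                                              ≡⟨ cong (_++ later a) (++-assoc (redWord (suc N) (suc a)) _ _) ⟩
    (redWord (suc N) (suc a) ++ redsInGap a g ++ gapBlue (suc N) g) ++ later a ≡⟨ ++-assoc (redWord (suc N) (suc a)) _ _ ⟩
    redWord (suc N) (suc a) ++ remaining a g r                                ∎
    where
    open ≡-Reasoning
    later : ℕ → List Letter
    later b = concatMap (λ g′ → redsInGap b g′ ++ gapBlue (suc N) g′) (segment (suc g) r)
    here-accept : redsInGap (suc a) g ≡ redWord (suc N) (suc a) ++ redsInGap a g
    here-accept = cong (concatMap (redWord (suc N))) (filter-accept (λ j → row Y j ≟ g) row≡g)
    later-reject : later (suc a) ≡ later a
    later-reject = cong concat (map-cong-local (segment-All⁺ (suc g) r λ g′ g<g′ _ →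
      cong (λ js → concatMap (redWord (suc N)) js ++ gapBlue (suc N) g′)
           (filter-reject (λ j → row Y j ≟ g′) (λ row≡g′ → <⇒≢ g<g′ (trans (sym row≡g) row≡g′)))))

  remaining-blue : ∀ {a g} r → (∀ j → 1 ≤ j → j ≤ a → row Y j ≢ g) → remaining a g (suc r) ≡ gapBlue (suc N) g ++ remaining a (suc g) r
  remaining-blue {a} {g} r row≢g =
    cong (λ js → (concatMap (redWord (suc N)) js ++ gapBlue (suc N) g) ++ remaining a (suc g) r)
         (filter-none (λ j → row Y j ≟ g) (applyDownFrom⁺₁ suc a λ i<a → row≢g (suc _) (s≤s z≤n) i<a))

  remaining-end : remaining 0 N 0 ≡ []
  remaining-end = cong (λ b → (if b then blueWord (suc N) (suc N) else []) ++ []) (≤ᵇ-false (n<1+n N))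

-- Chambers of one track

module Track {N : ℕ} (Y : Young (suc N)) {t s : ℕ} (t+s≡1+N : t + s ≡ suc N) (1≤t : 1 ≤ t) where

  s≤N : s ≤ N
  s≤N = ≤-pred (subst (suc s ≤_) t+s≡1+N (+-monoˡ-≤ s 1≤t))

  -- r_{x+1} and b_{x+1} both have length N ∸ x
  reachesTrack : ∀ {x} → x < s → t ≤ N ∸ x
  reachesTrack {x} x<s = m+n≤o⇒m≤o∸n t (≤-pred (subst₂ _≤_ (+-suc t x) t+s≡1+N (+-monoʳ-≤ t x<s)))

  belowTrack : ∀ {x} → s ≤ x → N ∸ x < t
  belowTrack {x} s≤x = ≤-<-trans (∸-monoʳ-≤ N s≤x)
    (+-cancelʳ-< s (N ∸ s) t (subst (_< t + s) (sym (m∸n+n≡m s≤N)) (subst (N <_) (sym t+s≡1+N) (n<1+n N))))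

  record OnPath (a g : ℕ) : Set where
    field
      a≤N       : a ≤ N
      g≤N       : g ≤ N
      g≤row     : 1 ≤ a → g ≤ row Y a
      nextRow≤g : a < N → row Y (suc a) ≤ g

  -- what OnPath a g says about (a ⊓ s, g ⊓ s)
  record OnBoundary (ρ κ : ℕ) : Set where
    field
      ρ≤s       : ρ ≤ s
      κ≤s       : κ ≤ s
      longRows  : ∀ x → 1 ≤ x → x ≤ ρ → κ ≤ row Y x
      shortRows : κ < s → ρ < s → ∀ x → ρ < x → x ≤ N → row Y x ≤ κ

  onPath⇒onBoundary : ∀ {a g} → OnPath a g → OnBoundary (a ⊓ s) (g ⊓ s)
  onPath⇒onBoundary {a} {g} P = record
    { ρ≤s       = m⊓n≤n a s
    ; κ≤s       = m⊓n≤n g s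
    ; longRows  = λ x 1≤x x≤a⊓s → let x≤a = ≤-trans x≤a⊓s (m⊓n≤m a s) in
        ≤-trans (m⊓n≤m g s) (≤-trans (g≤row (≤-trans 1≤x x≤a)) (row-antitone Y x a 1≤x x≤a a≤N))
    ; shortRows = λ g⊓s<s a⊓s<s x a⊓s<x x≤N → let a<x = subst (_< x) (⊓-<-right a⊓s<s) a⊓s<x in
        subst (row Y x ≤_) (sym (⊓-<-right g⊓s<s))
          (≤-trans (row-antitone Y (suc a) x (s≤s z≤n) a<x x≤N) (nextRow≤g (<-≤-trans a<x x≤N)))
    }
    where open OnPath P

  WellLabelled : ℕ → State → Set
  WellLabelled k st = Σ ℕ λ ρ → Σ ℕ λ κ → k + ρ ≡ s + κ × OnBoundary ρ κ ×
                      SameMinor (labelMinor t st) (minor (segment (suc ρ) t) (segment (suc κ) t))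

  relabel : ∀ {k st st′} → SameLabel t st st′ → WellLabelled k st′ → WellLabelled k st
  relabel same (ρ , κ , index , onBoundary , label) = ρ , κ , index , onBoundary , sameMinor-trans same label

  -- sts are the chambers k, k+1, …, 2s of track t
  data Chambers : ℕ → List State → Set where
    []  : Chambers (suc (s + s)) []
    _∷_ : ∀ {k st sts} → WellLabelled k st → Chambers (suc k) sts → Chambers k (st ∷ sts)

  Chambers-lookup : ∀ {k sts} j → Chambers k sts → k + j ≤ s + s →
                    Σ State λ st → head (drop j sts) ≡ just st × WellLabelled (k + j) st
  Chambers-lookup {k} j       []           k+j≤2s = ⊥-elim (<⇒≱ (s≤s (≤-refl {s + s})) (≤-trans (m≤m+n (suc (s + s)) j) k+j≤2s))
  Chambers-lookup {k} zero    (ok ∷ _)     _      = _ , refl , subst (λ i → WellLabelled i _) (sym (+-identityʳ k)) ok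
  Chambers-lookup {k} (suc j) (_ ∷ oks)    k+j≤2s with Chambers-lookup j oks (subst (_≤ s + s) (+-suc k j) k+j≤2s)
  ... | st , ≡st , ok = st , ≡st , subst (λ i → WellLabelled i st) (sym (+-suc k j)) ok

  -- the state after r_N, …, r_{a+1} and b_1, …, b_g, in chamber c
  record Stage (a g c : ℕ) (st : State) : Set where
    field
      redTent  : Tent N a (red st)
      blueTent : Tent N g (blue st)
      onPath   : OnPath a g
      index    : c + a ⊓ s ≡ s + g ⊓ s
  open Stage

  stage⇒wellLabelled : ∀ {a g c st} → Stage a g c st → WellLabelled c st
  stage⇒wellLabelled {a} {g} {st = st} S =
    a ⊓ s , g ⊓ s , index S , onPath⇒onBoundary (onPath S) ,
    subst (λ xs → SameMinor (minor (map (red st) xs) (map (blue st) xs)) (minor (segment (suc (a ⊓ s)) t) (segment (suc (g ⊓ s)) t)))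
          (sym (interval-segment 1 t))
      (tent-label t+s≡1+N (OnPath.a≤N (onPath S)) (redTent S) , tent-label t+s≡1+N (OnPath.g≤N (onPath S)) (blueTent S))

  stage-red : ∀ {a g c c′ st} → row Y (suc a) ≡ g → Stage (suc a) g c st → c′ + a ⊓ s ≡ s + g ⊓ s →
              Stage a g c′ (run st (redDescent (N ∸ a)))
  stage-red {a} {st = st} row≡g S index′ = record
    { redTent  = tent-cong (red-run (redDescent (N ∸ a)) st) (tent-redDescent (N ∸ a) (m∸n+n≡m a≤N) (redTent S))
    ; blueTent = tent-cong (λ h → trans (blue-run (redDescent (N ∸ a)) st h) (cong (blue st) (blueOrigin-redDescent (N ∸ a) h))) (blueTent S)
    ; onPath   = record
      { a≤N       = a≤N
      ; g≤N       = g≤N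
      ; g≤row     = λ 1≤a → subst (_≤ row Y a) row≡g (weaklyDec Y a 1≤a 1+a≤N)
      ; nextRow≤g = λ _ → ≤-reflexive row≡g
      }
    ; index    = index′
    }
    where
    open OnPath (onPath S) renaming (a≤N to 1+a≤N)
    a≤N : a ≤ N
    a≤N = ≤-trans (n≤1+n a) 1+a≤N

  stage-blue : ∀ {a g c c′ st} → g < N → (1 ≤ a → g < row Y a) → Stage a g c st → c′ + a ⊓ s ≡ s + suc g ⊓ s →
               Stage a (suc g) c′ (run st (blueAscent 1 (N ∸ g)))
  stage-blue {g = g} {st = st} g<N g<row S index′ = record
    { redTent  = tent-cong (λ h → trans (red-run (blueAscent 1 (N ∸ g)) st h) (cong (red st) (redOrigin-blueAscent 1 (N ∸ g) h))) (redTent S)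
    ; blueTent = tent-cong (blue-run (blueAscent 1 (N ∸ g)) st) (tent-blueAscent (N ∸ g) (m∸n+n≡m (<⇒≤ g<N)) (blueTent S))
    ; onPath   = record
      { a≤N       = a≤N
      ; g≤N       = g<N
      ; g≤row     = g<row
      ; nextRow≤g = λ a<N → m≤n⇒m≤1+n (nextRow≤g a<N)
      }
    ; index    = index′
    }
    where open OnPath (onPath S)

  redStep : ∀ {a g c st} w → row Y (suc a) ≡ g → Stage (suc a) g c st →
    (∀ {c′} → Stage a g c′ (run st (redDescent (N ∸ a))) → Chambers (suc c′) (afterTrackCrossings t (run st (redDescent (N ∸ a))) w)) →
    Chambers (suc c) (afterTrackCrossings t st (redDescent (N ∸ a) ++ w))
  redStep {a} {c = c} {st} w row≡g S continue rewrite afterTrackCrossings-++ t st (redDescent (N ∸ a)) w with a <? s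
  ... | yes a<s with redDescent-crossing t (N ∸ a) st 1≤t (reachesTrack a<s)
  ...   | stc , ≡[stc] , same rewrite ≡[stc] = relabel same (stage⇒wellLabelled S′) ∷ continue S′
    where
    S′ = stage-red row≡g S (trans (sym (+-suc c (a ⊓ s))) (trans (cong (c +_) (sym (⊓-suc-below a<s))) (index S)))
  redStep {a} {c = c} {st} w row≡g S continue | no a≮s
    rewrite redDescent-no-crossing t (N ∸ a) st (belowTrack (≮⇒≥ a≮s)) =
    continue (stage-red row≡g S (trans (cong (c +_) (sym (⊓-suc-above (≮⇒≥ a≮s)))) (index S)))

  blueStep : ∀ {a g c st} w → g < N → (1 ≤ a → g < row Y a) → Stage a g c st →
    (∀ {c′} → Stage a (suc g) c′ (run st (blueAscent 1 (N ∸ g))) → Chambers (suc c′) (afterTrackCrossings t (run st (blueAscent 1 (N ∸ g))) w)) →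
    Chambers (suc c) (afterTrackCrossings t st (blueAscent 1 (N ∸ g) ++ w))
  blueStep {g = g} {st = st} w g<N g<row S continue rewrite afterTrackCrossings-++ t st (blueAscent 1 (N ∸ g)) w with g <? s
  ... | yes g<s with blueAscent-crossing t (N ∸ g) st 1≤t (reachesTrack g<s)
  ...   | stc , ≡[stc] , same rewrite ≡[stc] = relabel same (stage⇒wellLabelled S′) ∷ continue S′
    where
    S′ = stage-blue g<N g<row S (trans (cong suc (index S)) (trans (sym (+-suc s (g ⊓ s))) (cong (s +_) (sym (⊓-suc-below g<s)))))
  blueStep {g = g} {st = st} w g<N g<row S continue | no g≮s
    rewrite blueAscent-no-crossing-below t 1 (N ∸ g) st (belowTrack (≮⇒≥ g≮s)) =
    continue (stage-blue g<N g<row S (trans (index S) (cong (s +_) (sym (⊓-suc-above (≮⇒≥ g≮s))))))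

  private
    viaRed : ∀ {a g c st} r → row Y (suc a) ≡ g → Stage (suc a) g c st →
      (∀ {c′ st′} → Stage a g c′ st′ → Chambers (suc c′) (afterTrackCrossings t st′ (remaining Y a g r))) →
      Chambers (suc c) (afterTrackCrossings t st (remaining Y (suc a) g r))
    viaRed {a} {g} {c} {st} r row≡g S continue =
      subst (Chambers (suc c) ∘ afterTrackCrossings t st)
            (sym (trans (remaining-red Y r row≡g) (cong (_++ remaining Y a g r) (redWord-descent N a))))
            (redStep (remaining Y a g r) row≡g S continue)

    viaBlue : ∀ {a g c st} r → g + suc r ≡ N → (1 ≤ a → g < row Y a) → Stage a g c st →
      (∀ {c′ st′} → Stage a (suc g) c′ st′ → Chambers (suc c′) (afterTrackCrossings t st′ (remaining Y a (suc g) r))) →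
      Chambers (suc c) (afterTrackCrossings t st (remaining Y a g (suc r)))
    viaBlue {a} {g} {c} {st} r g+1+r≡N g<row S continue =
      subst (Chambers (suc c) ∘ afterTrackCrossings t st)
            (sym (trans (remaining-blue Y r row≢g) (cong (_++ remaining Y a (suc g) r) (gapBlue-ascent g<N))))
            (blueStep (remaining Y a (suc g) r) g<N g<row S continue)
      where
      g<N : g < N
      g<N = subst (g <_) g+1+r≡N (m<m+n g z<s)
      row≢g : ∀ j → 1 ≤ j → j ≤ a → row Y j ≢ g
      row≢g j 1≤j j≤a = >⇒≢ (<-≤-trans (g<row (≤-trans 1≤j j≤a)) (row-antitone Y j a 1≤j j≤a (OnPath.a≤N (onPath S))))

  chambersAfter : ∀ a r {g c st} → g + r ≡ N → Stage a g c st → Chambers (suc c) (afterTrackCrossings t st (remaining Y a g r))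
  chambersAfter zero    zero    {g} {c} {st} g+0≡N S = subst₂ (λ k w → Chambers k (afterTrackCrossings t st w)) 2s+1≡1+c (sym end) []
    where
    g≡N : g ≡ N
    g≡N = trans (sym (+-identityʳ g)) g+0≡N
    end : remaining Y 0 g 0 ≡ []
    end = subst (λ x → remaining Y 0 x 0 ≡ []) (sym g≡N) (remaining-end Y)
    2s+1≡1+c : suc (s + s) ≡ suc c
    2s+1≡1+c = cong suc (sym (trans (sym (+-identityʳ c)) (trans (index S) (cong (s +_) (trans (cong (_⊓ s) g≡N) (m≥n⇒m⊓n≡n s≤N))))))
  chambersAfter zero    (suc r) g+1+r≡N S = viaBlue r g+1+r≡N (λ ()) S (chambersAfter zero r (trans (sym (+-suc _ r)) g+1+r≡N))
  chambersAfter (suc a) r {g} g+r≡N S with row Y (suc a) ≟ g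
  ... | yes row≡g = viaRed r row≡g S (chambersAfter a r g+r≡N)
  chambersAfter (suc a) zero    {g} g+0≡N S | no row≢g =
    ⊥-elim (row≢g (≤-antisym (subst (row Y (suc a) ≤_) (sym (trans (sym (+-identityʳ g)) g+0≡N)) (bounded Y (suc a) (s≤s z≤n) a≤N))
                             (g≤row (s≤s z≤n))))
    where open OnPath (onPath S)
  chambersAfter (suc a) (suc r) {g} g+1+r≡N S | no row≢g =
    viaBlue r g+1+r≡N (λ _ → ≤∧≢⇒< (OnPath.g≤row (onPath S) (s≤s z≤n)) (row≢g ∘ sym)) S
            (chambersAfter (suc a) r (trans (sym (+-suc g r)) g+1+r≡N))

  chambers : Chambers 0 (chamberStates (suc N) (DY (suc N) Y) t)
  chambers = stage⇒wellLabelled S₀ ∷ subst (Chambers 1 ∘ afterTrackCrossings t (initState (suc N))) (sym (DY≡remaining Y)) (chambersAfter N N refl S₀)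
    where
    S₀ : Stage N 0 0 (initState (suc N))
    S₀ = record
      { redTent  = tent-initRed
      ; blueTent = tent-initBlue
      ; onPath   = record { a≤N = ≤-refl ; g≤N = z≤n ; g≤row = λ _ → z≤n ; nextRow≤g = λ N<N → ⊥-elim (<-irrefl refl N<N) }
      ; index    = trans (m≥n⇒m⊓n≡n s≤N) (sym (+-identityʳ s))
      }

  private
    chamberMinor-just : ∀ w k st → head (drop k (chamberStates (suc N) w t)) ≡ just st → chamberMinor (suc N) w t k ≡ just (labelMinor t st)
    chamberMinor-just w k st ≡st with head (drop k (chamberStates (suc N) w t))
    chamberMinor-just w k st refl | just .st = refl

  chamber : ∀ k → k ≤ s + s → Σ ℕ λ ρ → Σ ℕ λ κ → k + ρ ≡ s + κ × OnBoundary ρ κ ×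
            chamberMinor (suc N) (DY (suc N) Y) t k IsMinor X[ 1 + ρ , t + ρ ][ 1 + κ , t + κ ]
  chamber k k≤2s with Chambers-lookup k chambers k≤2s
  ... | st , ≡st , ρ , κ , index , onBoundary , label =
    ρ , κ , index , onBoundary ,
    subst (_IsMinor X[ 1 + ρ , t + ρ ][ 1 + κ , t + κ ]) (sym (chamberMinor-just (DY (suc N) Y) k st ≡st))
          (subst₂ (λ xs ys → SameMinor (labelMinor t st) (minor xs ys)) (segment-interval ρ t) (segment-interval κ t) label)

  upper-count : ∀ K d {ρ} → K + d ≡ s → OnBoundary ρ (d + ρ) → K ⊓ boxesAbove (suc N) Y d ≡ ρ
  upper-count K d {ρ} K+d≡s B = ⊓-characterisation ρ≤K (subst (ρ ≤_) (sym (boxesAbove≡count Y d)) ρ≤count)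
                                                     (subst (_≤ ρ) (sym (boxesAbove≡count Y d)) ∘ count≤ρ)
    where
    open OnBoundary B
    ρ≤K : ρ ≤ K
    ρ≤K = +-cancelʳ-≤ d ρ K (subst₂ _≤_ (+-comm d ρ) (sym K+d≡s) κ≤s)
    HasBox? = λ x → x + d ≤? row Y x
    ρ≤count : ρ ≤ count HasBox? (segment 1 N)
    ρ≤count = count-segment-≥ HasBox? 1 0 ρ N (≤-trans ρ≤s s≤N) λ h 1≤h h<1+ρ →
      ≤-trans (≤-trans (+-monoˡ-≤ d (≤-pred h<1+ρ)) (≤-reflexive (+-comm ρ d))) (longRows h 1≤h (≤-pred h<1+ρ))
    count≤ρ : ρ < K → count HasBox? (segment 1 N) ≤ ρ
    count≤ρ ρ<K = count-segment-≤ HasBox? 1 0 ρ N (≤-trans ρ≤s s≤N) λ h 1≤h h<1+N h+d≤row → 1≤h , s≤s (h≤ρ h h<1+N h+d≤row)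
      where
      d+ρ<s : d + ρ < s
      d+ρ<s = subst₂ _<_ (+-comm ρ d) K+d≡s (+-monoˡ-< d ρ<K)
      h≤ρ : ∀ h → h < 1 + N → h + d ≤ row Y h → h ≤ ρ
      h≤ρ h h<1+N h+d≤row with h ≤? ρ
      ... | yes h≤ρ = h≤ρ
      ... | no  h≰ρ = ⊥-elim (h≰ρ (+-cancelʳ-≤ d h ρ (≤-trans h+d≤row (≤-trans
              (shortRows d+ρ<s (≤-<-trans (m≤n+m ρ d) d+ρ<s) h (≰⇒> h≰ρ) (≤-pred h<1+N)) (≤-reflexive (+-comm d ρ))))))

  lower-count : ∀ K d {κ} → K + d ≡ s → OnBoundary (d + κ) κ → K ⊓ boxesBelow (suc N) Y d ≡ κ
  lower-count K d {κ} K+d≡s B = ⊓-characterisation κ≤K (subst (κ ≤_) (sym (boxesBelow≡count Y d)) κ≤count)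
                                                     (subst (_≤ κ) (sym (boxesBelow≡count Y d)) ∘ count≤κ)
    where
    open OnBoundary B
    κ≤K : κ ≤ K
    κ≤K = +-cancelʳ-≤ d κ K (subst₂ _≤_ (+-comm d κ) (sym K+d≡s) ρ≤s)
    HasBox? = λ x → (d <? x) ×-dec (x ≤? row Y x + d)
    κ≤count : κ ≤ count HasBox? (segment 1 N)
    κ≤count = count-segment-≥ HasBox? 1 d κ N (≤-trans ρ≤s s≤N) λ h 1+d≤h h<1+d+κ →
      1+d≤h , ≤-trans (≤-pred h<1+d+κ)
                (subst (d + κ ≤_) (+-comm d (row Y h)) (+-monoʳ-≤ d (longRows h (≤-trans (s≤s z≤n) 1+d≤h) (≤-pred h<1+d+κ))))
    count≤κ : κ < K → count HasBox? (segment 1 N) ≤ κ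
    count≤κ κ<K = count-segment-≤ HasBox? 1 d κ N (≤-trans ρ≤s s≤N) λ { h 1≤h h<1+N (d<h , h≤row+d) → d<h , s≤s (h≤d+κ h h<1+N h≤row+d) }
      where
      d+κ<s : d + κ < s
      d+κ<s = subst₂ _<_ (+-comm κ d) K+d≡s (+-monoˡ-< d κ<K)
      h≤d+κ : ∀ h → h < 1 + N → h ≤ row Y h + d → h ≤ d + κ
      h≤d+κ h h<1+N h≤row+d with h ≤? d + κ
      ... | yes h≤d+κ = h≤d+κ
      ... | no  h≰d+κ = ⊥-elim (h≰d+κ (≤-trans h≤row+d (≤-trans
              (+-monoˡ-≤ d (shortRows (≤-<-trans (m≤n+m κ d) d+κ<s) d+κ<s h (≰⇒> h≰d+κ) (≤-pred h<1+N))) (≤-reflexive (+-comm κ d)))))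

  chamber-upper : ∀ K d → K + d ≡ s → let p = K ⊓ boxesAbove (suc N) Y d in
    chamberMinor (suc N) (DY (suc N) Y) t (s + d) IsMinor X[ 1 + p , t + p ][ 1 + (d + p) , t + (d + p) ]
  chamber-upper K d K+d≡s with chamber (s + d) (+-monoʳ-≤ s (subst (d ≤_) K+d≡s (m≤n+m d K)))
  ... | ρ , κ , index , B , isMinor =
    subst (λ p → _ IsMinor X[ 1 + p , t + p ][ 1 + (d + p) , t + (d + p) ]) (sym (upper-count K d K+d≡s (subst (OnBoundary ρ) κ≡d+ρ B)))
          (subst (λ q → _ IsMinor X[ 1 + ρ , t + ρ ][ 1 + q , t + q ]) κ≡d+ρ isMinor)
    where
    κ≡d+ρ : κ ≡ d + ρ
    κ≡d+ρ = sym (+-cancelˡ-≡ s (d + ρ) κ (trans (sym (+-assoc s d ρ)) index))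

  chamber-lower : ∀ K d → K + d ≡ s → let q = K ⊓ boxesBelow (suc N) Y d in
    chamberMinor (suc N) (DY (suc N) Y) t K IsMinor X[ 1 + (d + q) , t + (d + q) ][ 1 + q , t + q ]
  chamber-lower K d K+d≡s with chamber K (≤-trans (subst (K ≤_) K+d≡s (m≤m+n K d)) (m≤m+n s s))
  ... | ρ , κ , index , B , isMinor =
    subst (λ q → _ IsMinor X[ 1 + (d + q) , t + (d + q) ][ 1 + q , t + q ]) (sym (lower-count K d K+d≡s (subst (λ r → OnBoundary r κ) ρ≡d+κ B)))
          (subst (λ r → _ IsMinor X[ 1 + r , t + r ][ 1 + κ , t + κ ]) ρ≡d+κ isMinor)
    where
    ρ≡d+κ : ρ ≡ d + κ
    ρ≡d+κ = +-cancelˡ-≡ K ρ (d + κ) (trans index (trans (cong (_+ κ) (sym K+d≡s)) (+-assoc K d κ)))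

-- The entries of m

isMinor-cong : ∀ {mb a b c d a′ b′ c′ d′} → a ≡ a′ → b ≡ b′ → c ≡ c′ → d ≡ d′ →
               mb IsMinor X[ a , b ][ c , d ] → mb IsMinor X[ a′ , b′ ][ c′ , d′ ]
isMinor-cong refl refl refl refl isMinor = isMinor

module _ {N : ℕ} (Y : Young (suc N)) where

  private
    n = suc N

    ∸-split : ∀ {i j} → i ≤ j → j ≤ n → (n ∸ j) + (j ∸ i) ≡ n ∸ i
    ∸-split {i} {j} i≤j j≤n = +-cancelʳ-≡ i _ _ (begin
      n ∸ j + (j ∸ i) + i    ≡⟨ +-assoc (n ∸ j) (j ∸ i) i ⟩
      n ∸ j + (j ∸ i + i)    ≡⟨ cong (n ∸ j +_) (m∸n+n≡m i≤j) ⟩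
      n ∸ j + j              ≡⟨ m∸n+n≡m j≤n ⟩
      n                      ≡⟨ m∸n+n≡m (≤-trans i≤j j≤n) ⟨
      n ∸ i + i              ∎)
      where open ≡-Reasoning

    shifted-end : ∀ {i j} p → i ≤ j → i + (j ∸ i + p) ≡ j + p
    shifted-end {i} {j} p i≤j = trans (sym (+-assoc i (j ∸ i) p)) (cong (_+ p) (m+[n∸m]≡n i≤j))

  diagonalEntry : ∀ j → 1 ≤ j → j ≤ n → mEntry n Y j j IsMinor X[ 1 + D n Y j , j + D n Y j ][ 1 + D n Y j , j + D n Y j ]
  -- D n Y j is definitionally the minimum of chamber-upper at d = 0
  diagonalEntry j 1≤j j≤n rewrite ≤ᵇ-true (≤-refl {j}) =
    subst (λ k → chamberMinor n (DY n Y) j k IsMinor X[ 1 + D n Y j , j + D n Y j ][ 1 + D n Y j , j + D n Y j ]) (+-identityʳ (n ∸ j))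
          (Track.chamber-upper Y (m+[n∸m]≡n j≤n) 1≤j (n ∸ j) 0 (+-identityʳ (n ∸ j)))

  upperEntry : ∀ i j → 1 ≤ i → i < j → j ≤ n →
    mEntry n Y i j IsMinor X[ 1 + P n Y j i , i + P n Y j i ][ j ∸ i + P n Y j i + 1 , j + P n Y j i ]
  upperEntry i j 1≤i i<j j≤n rewrite ≤ᵇ-false i<j =
    isMinor-cong refl refl (+-comm 1 (j ∸ i + P n Y j i)) (shifted-end (P n Y j i) (<⇒≤ i<j))
      (Track.chamber-upper Y (m+[n∸m]≡n (≤-trans (<⇒≤ i<j) j≤n)) 1≤i (n ∸ j) (j ∸ i) (∸-split (<⇒≤ i<j) j≤n))

  lowerEntry : ∀ i j → 1 ≤ i → i < j → j ≤ n →
    mEntry n Y j i IsMinor X[ j ∸ i + B n Y j i + 1 , j + B n Y j i ][ 1 + B n Y j i , i + B n Y j i ]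
  lowerEntry i j 1≤i i<j j≤n rewrite ≤ᵇ-true (<⇒≤ i<j) =
    isMinor-cong (+-comm 1 (j ∸ i + B n Y j i)) (shifted-end (B n Y j i) (<⇒≤ i<j)) refl refl
      (Track.chamber-lower Y (m+[n∸m]≡n (≤-trans (<⇒≤ i<j) j≤n)) 1≤i (n ∸ j) (j ∸ i) (∸-split (<⇒≤ i<j) j≤n))

proposition5p10 : (n : ℕ) → 2 ≤ n → (Y : Young n) →
    ((j : ℕ) → 1 ≤ j → j ≤ n →
      mEntry n Y j j IsMinor X[ 1 + D n Y j , j + D n Y j ][ 1 + D n Y j , j + D n Y j ])
    × ((i j : ℕ) → 1 ≤ i → i < j → j ≤ n →
      (mEntry n Y i j IsMinor X[ 1 + P n Y j i , i + P n Y j i ][ j ∸ i + P n Y j i + 1 , j + P n Y j i ])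
      × (mEntry n Y j i IsMinor X[ j ∸ i + B n Y j i + 1 , j + B n Y j i ][ 1 + B n Y j i , i + B n Y j i ]))
proposition5p10 (suc N) _ Y =
  diagonalEntry Y , λ i j 1≤i i<j j≤n → upperEntry Y i j 1≤i i<j j≤n , lowerEntry Y i j 1≤i i<j j≤n
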